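{- Let $G$ and $H$ be two connected graphs with $G\neq K_1$. Then: (i) if $D(G)=1$, then $D(G\circ H)=D(H)$; (ii) $D(G\circ H)=1$ if and only if $D(G)=D(H)=1$.
   Context: The corona $G\circ H$ is obtained by taking one copy of $G$ and $|V(G)|$ copies of $H$ and joining the $i$-th vertex of $G$ to every vertex of the $i$-th copy of $H$. $K_1$ is the single-vertex graph. The distinguishing number $D(G)$ is the least $r$ such that some vertex labeling $V(G)\to\{1,\dots,r\}$ is preserved by no non-identity automorphism of $G$. -}

module Defs where

open import Data.Nat using (ℕ; _≤_; _<_)
open import Data.Fin using (Fin)
open import Data.Product using (Σ; ∃; _×_; _,_)
open import Data.Sum using (_⊎_; inj₁; inj₂)
open import Data.Empty using (⊥)
open import Function.Bundles using (_↔_; _⇔_)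
open import Relation.Nullary using (¬_)
open import Relation.Binary.PropositionalEquality using (_≡_)

record Graph : Set₁ where
  field
    V     : Set
    E     : V → V → Set
    sym   : ∀ {u v} → E u v → E v u
    irrefl : ∀ {v} → ¬ E v v
open Graph public

Finite : Graph → Set
Finite G = Σ ℕ λ n → V G ↔ Fin n

data Walk (G : Graph) : V G → V G → Set where
  here : ∀ {v} → Walk G v v
  step : ∀ {u w v} → E G u w → Walk G w v → Walk G u v

Connected : Graph → Set
Connected G = V G × (∀ u v → Walk G u v)

-- G ≠ K₁ (for a connected, hence nonempty graph): two distinct vertices.
NotK1 : Graph → Set
NotK1 G = Σ (V G) λ u → Σ (V G) λ v → ¬ (u ≡ v)

record Automorphism (G : Graph) : Set where
  field
    f       : V G → V G
    g       : V G → V G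
    left    : ∀ v → g (f v) ≡ v
    right   : ∀ v → f (g v) ≡ v
    preserve : ∀ u v → E G u v ⇔ E G (f u) (f v)
open Automorphism public

Preserves : (G : Graph) {r : ℕ} → (V G → Fin r) → Automorphism G → Set
Preserves G c φ = ∀ v → c (f φ v) ≡ c v

Distinguishing : (G : Graph) {r : ℕ} → (V G → Fin r) → Set
Distinguishing G c = ∀ (φ : Automorphism G) → Preserves G c φ → ∀ v → f φ v ≡ v

-- r-distinguishable: some labeling with labels {1..r} (modelled as Fin r).
Distinguishable : Graph → ℕ → Set
Distinguishable G r = Σ (V G → Fin r) λ c → Distinguishing G c

IsDistNum : Graph → ℕ → Set
IsDistNum G r = (1 ≤ r) × Distinguishable G r × (∀ s → 1 ≤ s → s < r → ¬ Distinguishable G s)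

-- Corona G ∘ H: vertices inj₁ a (copy of G) and inj₂ (a , h) (vertex h of
-- the a-th copy of H).
data CoronaE (G H : Graph) : V G ⊎ (V G × V H) → V G ⊎ (V G × V H) → Set where
  gg : ∀ {a b} → E G a b → CoronaE G H (inj₁ a) (inj₁ b)
  hh : ∀ {a h h'} → E H h h' → CoronaE G H (inj₂ (a , h)) (inj₂ (a , h'))
  gh : ∀ {a h} → CoronaE G H (inj₁ a) (inj₂ (a , h))
  hg : ∀ {a h} → CoronaE G H (inj₂ (a , h)) (inj₁ a)

corona : Graph → Graph → Graph
corona G H = record
  { V = V G ⊎ (V G × V H)
  ; E = CoronaE G H
  ; sym = λ { (gg e) → gg (sym G e) ; (hh e) → hh (sym H e) ; gh → hg ; hg → gh }
  ; irrefl = λ { (gg e) → irrefl G e ; (hh e) → irrefl H e }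
  }

-- A vertex of G has, besides the |H| vertices of its copy of H, a neighbour in G (G is connected and not
-- K₁), while a vertex of a copy of H has at most |H| neighbours. So no automorphism of G ∘ H moves a vertex
-- of G into a copy of H, and every automorphism of G ∘ H restricts to an automorphism of G. If G is
-- asymmetric, it therefore fixes G pointwise and acts on each copy of H separately, so a distinguishing
-- labelling of H copied onto every copy distinguishes G ∘ H. Conversely, an automorphism of H acting on a
-- single copy, and an automorphism of G permuting the copies, are automorphisms of G ∘ H: restricting a
-- distinguishing labelling of G ∘ H to one copy distinguishes H, and D(G ∘ H) = 1 forces D(G) = 1.
module Submission where

open import Defs hiding (sym)
open import Data.Empty using (⊥-elim)
open import Data.Fin using (Fin; zero; suc)
open import Data.Fin.Properties using (injective⇒≤; inj⇒≟)
open import Data.Maybe using (Maybe; just; nothing)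
open import Data.Maybe.Properties using (just-injective)
open import Data.Nat using (suc; s≤s; z≤n)
open import Data.Nat.Properties using (1+n≰n)
open import Data.Product using (Σ; _×_; _,_; proj₁; proj₂)
open import Data.Sum using (inj₁; inj₂)
open import Data.Sum.Properties using (inj₁-injective; inj₂-injective)
open import Function using (_∘_; id)
open import Function.Bundles using (_⇔_; _↔_; mk⇔; Inverse; Injection; Equivalence)
open import Function.Definitions using (Injective)
open import Function.Properties.Equivalence as ⇔ using ()
open import Function.Properties.Inverse using (↔⇒↣)
open import Relation.Binary.Definitions using (DecidableEquality)
open import Relation.Nullary using (¬_; yes; no)
open import Relation.Binary.PropositionalEquality
  using (_≡_; _≢_; refl; sym; trans; cong; cong₂; subst; subst₂; module ≡-Reasoning)

finite⇒≡-dec : (X : Graph) → Finite X → DecidableEquality (V X)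
finite⇒≡-dec X (n , V↔Fin) = inj⇒≟ (↔⇒↣ V↔Fin)

finite⇒¬Maybe↣ : ∀ {A : Set} {n} → A ↔ Fin n → (k : Maybe A → A) → ¬ Injective _≡_ _≡_ k
finite⇒¬Maybe↣ {A} {n} A↔Fin k k-injective =
  1+n≰n (injective⇒≤ {f = to ∘ k ∘ fromFin} (fromFin-injective ∘ k-injective ∘ to-injective))
  where
    open Inverse A↔Fin using (to; from; strictlyInverseˡ)
    to-injective : Injective _≡_ _≡_ to
    to-injective = Injection.injective (↔⇒↣ A↔Fin)

    fromFin : Fin (suc n) → Maybe A
    fromFin zero    = nothing
    fromFin (suc i) = just (from i)

    fromFin-injective : Injective _≡_ _≡_ fromFin
    fromFin-injective {zero}  {zero}  _ = refl
    fromFin-injective {suc i} {suc j} p =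
      cong suc (trans (sym (strictlyInverseˡ i)) (trans (cong to (just-injective p)) (strictlyInverseˡ j)))

EdgePreserving : (X : Graph) → (V X → V X) → Set
EdgePreserving X F = ∀ {u v} → E X u v → E X (F u) (F v)

mkAutomorphism : (X : Graph) (F F⁻¹ : V X → V X) →
  (∀ v → F⁻¹ (F v) ≡ v) → (∀ v → F (F⁻¹ v) ≡ v) →
  EdgePreserving X F → EdgePreserving X F⁻¹ → Automorphism X
mkAutomorphism X F F⁻¹ cancelˡ cancelʳ F-preserves F⁻¹-preserves = record
  { f = F ; g = F⁻¹ ; left = cancelˡ ; right = cancelʳ
  ; preserve = λ u v → mk⇔ F-preserves (subst₂ (E X) (cancelˡ u) (cancelˡ v) ∘ F⁻¹-preserves)
  }

module _ {X : Graph} where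

  automorphism-preserves : (φ : Automorphism X) → EdgePreserving X (f φ)
  automorphism-preserves φ = Equivalence.to (preserve φ _ _)

  automorphism-injective : (φ : Automorphism X) → Injective _≡_ _≡_ (f φ)
  automorphism-injective φ {u} {v} φu≡φv = trans (sym (left φ u)) (trans (cong (g φ) φu≡φv) (left φ v))

  _⁻¹ : Automorphism X → Automorphism X
  φ ⁻¹ = mkAutomorphism X (g φ) (f φ) (right φ) (left φ) g-preserves (automorphism-preserves φ)
    where
      g-preserves : EdgePreserving X (g φ)
      g-preserves {u} {v} e =
        Equivalence.from (preserve φ (g φ u) (g φ v)) (subst₂ (E X) (sym (right φ u)) (sym (right φ v)) e)

identity : (X : Graph) → Automorphism X
identity X = mkAutomorphism X id id (λ _ → refl) (λ _ → refl) id id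

Asymmetric : Graph → Set
Asymmetric X = ∀ (φ : Automorphism X) v → f φ v ≡ v

module _ {X : Graph} where

  distinguishable-1⇒asymmetric : Distinguishable X 1 → Asymmetric X
  distinguishable-1⇒asymmetric (c , distinguishing) φ =
    distinguishing φ (λ v → Fin1-irrelevant (c (f φ v)) (c v))
    where
      Fin1-irrelevant : (i j : Fin 1) → i ≡ j
      Fin1-irrelevant zero zero = refl

  isDistNum-1⇔asymmetric : IsDistNum X 1 ⇔ Asymmetric X
  isDistNum-1⇔asymmetric = mk⇔
    (λ (_ , distinguishable , _) → distinguishable-1⇒asymmetric distinguishable)
    (λ asymmetric → s≤s z≤n , ((λ _ → zero) , λ φ _ → asymmetric φ) , λ { _ (s≤s _) (s≤s ()) })

isDistNum-cong : {X Y : Graph} → (∀ s → Distinguishable X (suc s) ⇔ Distinguishable Y (suc s)) →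
  ∀ r → IsDistNum X r ⇔ IsDistNum Y r
isDistNum-cong {X} {Y} X⇔Y r = mk⇔ (transfer X⇔Y) (transfer (λ s → ⇔.sym (X⇔Y s)))
  where
    transfer : {A B : Graph} → (∀ s → Distinguishable A (suc s) ⇔ Distinguishable B (suc s)) →
      IsDistNum A r → IsDistNum B r
    transfer A⇔B (s≤s z≤n , distinguishable , minimal) =
      s≤s z≤n , Equivalence.to (A⇔B _) distinguishable ,
      λ { (suc s) _ s<r → minimal (suc s) (s≤s z≤n) s<r ∘ Equivalence.from (A⇔B s) }

record InducedSubgraph (Y X : Graph) : Set where
  field
    embed           : V Y → V X
    embed-injective : Injective _≡_ _≡_ embed
    embed-preserves : ∀ {u v} → E Y u v → E X (embed u) (embed v)
    embed-reflects  : ∀ {u v} → E X (embed u) (embed v) → E Y u v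

module _ {Y X : Graph} (ι : InducedSubgraph Y X) where
  open InducedSubgraph ι

  Invariant : Automorphism X → Set
  Invariant φ = ∀ y → Σ (V Y) λ y′ → f φ (embed y) ≡ embed y′

  private
    restriction-preserves : (φ : Automorphism X) (φ-inv : Invariant φ) → EdgePreserving Y (proj₁ ∘ φ-inv)
    restriction-preserves φ φ-inv {u} {v} e =
      embed-reflects (subst₂ (E X) (proj₂ (φ-inv u)) (proj₂ (φ-inv v)) (automorphism-preserves φ (embed-preserves e)))

    restriction-cancel : (φ ψ : Automorphism X) → (∀ x → f ψ (f φ x) ≡ x) →
      (φ-inv : Invariant φ) (ψ-inv : Invariant ψ) → ∀ y → proj₁ (ψ-inv (proj₁ (φ-inv y))) ≡ y
    restriction-cancel φ ψ ψφ≗id φ-inv ψ-inv y = embed-injective (begin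
      embed (proj₁ (ψ-inv (proj₁ (φ-inv y)))) ≡⟨ sym (proj₂ (ψ-inv _)) ⟩
      f ψ (embed (proj₁ (φ-inv y)))            ≡⟨ cong (f ψ) (sym (proj₂ (φ-inv y))) ⟩
      f ψ (f φ (embed y))                      ≡⟨ ψφ≗id (embed y) ⟩
      embed y                                  ∎)
      where open ≡-Reasoning

  restrict : (φ : Automorphism X) → Invariant φ → Invariant (φ ⁻¹) → Automorphism Y
  restrict φ φ-inv φ⁻¹-inv = mkAutomorphism Y (proj₁ ∘ φ-inv) (proj₁ ∘ φ⁻¹-inv)
    (restriction-cancel φ (φ ⁻¹) (left φ) φ-inv φ⁻¹-inv)
    (restriction-cancel (φ ⁻¹) φ (right φ) φ⁻¹-inv φ-inv)
    (restriction-preserves φ φ-inv) (restriction-preserves (φ ⁻¹) φ⁻¹-inv)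

  restrict-embed : (φ : Automorphism X) (φ-inv : Invariant φ) (φ⁻¹-inv : Invariant (φ ⁻¹)) →
    ∀ y → embed (f (restrict φ φ-inv φ⁻¹-inv) y) ≡ f φ (embed y)
  restrict-embed φ φ-inv _ y = sym (proj₂ (φ-inv y))

Neighbour : (X : Graph) → V X → Set
Neighbour X v = Σ (V X) (E X v)

walks-to-distinct⇒neighbour : ∀ {X a u v} → Walk X a u → Walk X a v → u ≢ v → Neighbour X a
walks-to-distinct⇒neighbour (step e _) _          _   = _ , e
walks-to-distinct⇒neighbour here       (step e _) _   = _ , e
walks-to-distinct⇒neighbour here       here       u≢v = ⊥-elim (u≢v refl)

record NeighbourEmbedding (X : Graph) (A : Set) (v : V X) : Set where
  field
    neighbour           : A → V X
    neighbour-adjacent  : ∀ a → E X v (neighbour a)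
    neighbour-injective : Injective _≡_ _≡_ neighbour

automorphism-neighbourEmbedding : ∀ {X A v} (φ : Automorphism X) →
  NeighbourEmbedding X A v → NeighbourEmbedding X A (f φ v)
automorphism-neighbourEmbedding φ ν = record
  { neighbour           = f φ ∘ neighbour
  ; neighbour-adjacent  = automorphism-preserves φ ∘ neighbour-adjacent
  ; neighbour-injective = neighbour-injective ∘ automorphism-injective φ
  }
  where open NeighbourEmbedding ν

module Corona (G H : Graph) where

  G∘H : Graph
  G∘H = corona G H

  base : InducedSubgraph G G∘H
  base = record
    { embed = inj₁ ; embed-injective = inj₁-injective
    ; embed-preserves = gg ; embed-reflects = λ { (gg e) → e } }

  copy : V G → InducedSubgraph H G∘H
  copy a = record
    { embed = λ h → inj₂ (a , h) ; embed-injective = cong proj₂ ∘ inj₂-injective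
    ; embed-preserves = hh ; embed-reflects = λ { (hh e) → e } }

  base-neighbourEmbedding : ∀ {a} → Neighbour G a → NeighbourEmbedding G∘H (Maybe (V H)) (inj₁ a)
  base-neighbourEmbedding {a} (b , a~b) = record
    { neighbour = neighbour ; neighbour-adjacent = adjacent ; neighbour-injective = injective }
    where
      neighbour : Maybe (V H) → V G∘H
      neighbour nothing  = inj₁ b
      neighbour (just h) = inj₂ (a , h)
      adjacent : ∀ m → CoronaE G H (inj₁ a) (neighbour m)
      adjacent nothing  = gg a~b
      adjacent (just _) = gh
      injective : Injective _≡_ _≡_ neighbour
      injective {nothing} {nothing} _ = refl
      injective {just _}  {just _}  p = cong just (cong proj₂ (inj₂-injective p))

  copy-neighbourLabel : ∀ {b h w} → CoronaE G H (inj₂ (b , h)) w → V H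
  copy-neighbourLabel (hh {h' = h′} _) = h′
  copy-neighbourLabel {h = h} hg       = h

  copy-neighbourLabel-injective : ∀ {b h w w′} (e : CoronaE G H (inj₂ (b , h)) w) (e′ : CoronaE G H (inj₂ (b , h)) w′) →
    copy-neighbourLabel e ≡ copy-neighbourLabel e′ → w ≡ w′
  copy-neighbourLabel-injective (hh _) (hh _) refl = refl
  copy-neighbourLabel-injective hg hg _ = refl
  copy-neighbourLabel-injective {h = h} (hh h~h′) hg h′≡h = ⊥-elim (irrefl H (subst (E H h) h′≡h h~h′))
  copy-neighbourLabel-injective {h = h} hg (hh h~h′) h≡h′ = ⊥-elim (irrefl H (subst (E H h) (sym h≡h′) h~h′))

  copy-¬neighbourEmbedding : Finite H → ∀ {b h} → ¬ NeighbourEmbedding G∘H (Maybe (V H)) (inj₂ (b , h))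
  copy-¬neighbourEmbedding (_ , V↔Fin) ν = finite⇒¬Maybe↣ V↔Fin
    (copy-neighbourLabel ∘ neighbour-adjacent)
    (λ {m} {m′} → neighbour-injective ∘ copy-neighbourLabel-injective (neighbour-adjacent m) (neighbour-adjacent m′))
    where open NeighbourEmbedding ν

  base-neighbour-outside-base : ∀ {a w} → CoronaE G H (inj₁ a) w → (∀ b → w ≢ inj₁ b) →
    Σ (V H) λ h → w ≡ inj₂ (a , h)
  base-neighbour-outside-base (gg _)         w∉base = ⊥-elim (w∉base _ refl)
  base-neighbour-outside-base (gh {h = h}) _      = h , refl

  coronaMap : (V G → V G) → (V G → V H → V H) → V G∘H → V G∘H
  coronaMap α β (inj₁ a)       = inj₁ (α a)
  coronaMap α β (inj₂ (a , h)) = inj₂ (α a , β a h)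

  coronaMap-preserves : ∀ {α β} → EdgePreserving G α → (∀ a → EdgePreserving H (β a)) →
    EdgePreserving G∘H (coronaMap α β)
  coronaMap-preserves α-preserves β-preserves (gg e) = gg (α-preserves e)
  coronaMap-preserves α-preserves β-preserves (hh {a} e) = hh (β-preserves a e)
  coronaMap-preserves α-preserves β-preserves gh = gh
  coronaMap-preserves α-preserves β-preserves hg = hg

  coronaAutomorphism : Automorphism G → (V G → Automorphism H) → Automorphism G∘H
  coronaAutomorphism α β = mkAutomorphism G∘H
    (coronaMap (f α) (f ∘ β)) (coronaMap (g α) β⁻¹) cancelˡ cancelʳ
    (coronaMap-preserves (automorphism-preserves α) (automorphism-preserves ∘ β))
    (coronaMap-preserves (automorphism-preserves (α ⁻¹)) (λ a → automorphism-preserves (β (g α a) ⁻¹)))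
    where
      β⁻¹ : V G → V H → V H
      β⁻¹ a = g (β (g α a))

      copy-cancelˡ : ∀ {a a′} h → a′ ≡ a → inj₂ (a′ , g (β a′) (f (β a) h)) ≡ inj₂ (a , h)
      copy-cancelˡ {a} h refl = cong (λ h′ → inj₂ (a , h′)) (left (β a) h)

      cancelˡ : ∀ v → coronaMap (g α) β⁻¹ (coronaMap (f α) (f ∘ β) v) ≡ v
      cancelˡ (inj₁ a)       = cong inj₁ (left α a)
      cancelˡ (inj₂ (a , h)) = copy-cancelˡ h (left α a)

      cancelʳ : ∀ v → coronaMap (f α) (f ∘ β) (coronaMap (g α) β⁻¹ v) ≡ v
      cancelʳ (inj₁ a)       = cong inj₁ (right α a)
      cancelʳ (inj₂ (a , h)) = cong₂ (λ a′ h′ → inj₂ (a′ , h′)) (right α a) (right (β (g α a)) h)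

  asymmetric-corona⇒asymmetric-base : Asymmetric G∘H → Asymmetric G
  asymmetric-corona⇒asymmetric-base asymmetric α a =
    inj₁-injective (asymmetric (coronaAutomorphism α (λ _ → identity H)) (inj₁ a))

  module OnOneCopy (_≟_ : DecidableEquality (V G)) (a₀ : V G) (ψ : Automorphism H) where

    onCopy : V G → Automorphism H
    onCopy a with a ≟ a₀
    ... | yes _ = ψ
    ... | no _  = identity H

    onCopy-a₀ : onCopy a₀ ≡ ψ
    onCopy-a₀ with a₀ ≟ a₀
    ... | yes _   = refl
    ... | no a₀≢a₀ = ⊥-elim (a₀≢a₀ refl)

    onCopy-preserves : ∀ {L : Set} (c : V G → V H → L) → (∀ h → c a₀ (f ψ h) ≡ c a₀ h) →
      ∀ a h → c a (f (onCopy a) h) ≡ c a h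
    onCopy-preserves c ψ-preserves a h with a ≟ a₀
    ... | yes refl = ψ-preserves h
    ... | no _     = refl

  copy-distinguishable : DecidableEquality (V G) → V G → ∀ {s} → Distinguishable G∘H s → Distinguishable H s
  copy-distinguishable _≟_ a₀ (c , distinguishing) = c ∘ embed , distinguishing-copy
    where
      open InducedSubgraph (copy a₀)
      distinguishing-copy : Distinguishing H (c ∘ embed)
      distinguishing-copy ψ ψ-preserves h = begin
        f ψ h              ≡⟨ cong (λ χ → f χ h) (sym onCopy-a₀) ⟩
        f (onCopy a₀) h    ≡⟨ embed-injective (distinguishing φ φ-preserves (embed h)) ⟩
        h                  ∎
        where
          open ≡-Reasoning
          open OnOneCopy _≟_ a₀ ψ
          φ : Automorphism G∘H
          φ = coronaAutomorphism (identity G) onCopy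
          φ-preserves : Preserves G∘H c φ
          φ-preserves (inj₁ a)       = refl
          φ-preserves (inj₂ (a , h)) = onCopy-preserves (λ a h → c (inj₂ (a , h))) ψ-preserves a h

  module BaseInvariance (finH : Finite H) (hasNeighbour : ∀ a → Neighbour G a) where

    base-invariant : (φ : Automorphism G∘H) → Invariant base φ
    base-invariant φ a with f φ (inj₁ a) in φa≡
    ... | inj₁ b = b , refl
    ... | inj₂ _ = ⊥-elim (copy-¬neighbourEmbedding finH
      (subst (NeighbourEmbedding G∘H (Maybe (V H))) φa≡
        (automorphism-neighbourEmbedding φ (base-neighbourEmbedding (hasNeighbour a)))))

    copy-image-outside-base : (φ : Automorphism G∘H) → ∀ x b → f φ (inj₂ x) ≢ inj₁ b
    copy-image-outside-base φ x b φx≡b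
      with trans (sym (left φ (inj₂ x))) (trans (cong (g φ) φx≡b) (proj₂ (base-invariant (φ ⁻¹) b)))
    ... | ()

    restrictToBase : Automorphism G∘H → Automorphism G
    restrictToBase φ = restrict base φ (base-invariant φ) (base-invariant (φ ⁻¹))

    module OverAsymmetricBase (asymmetricG : Asymmetric G) where

      base-fixed : (φ : Automorphism G∘H) → ∀ a → f φ (inj₁ a) ≡ inj₁ a
      base-fixed φ a = trans
        (sym (restrict-embed base φ (base-invariant φ) (base-invariant (φ ⁻¹)) a))
        (cong inj₁ (asymmetricG (restrictToBase φ) a))

      copy-invariant : (φ : Automorphism G∘H) → ∀ a → Invariant (copy a) φ
      copy-invariant φ a h = base-neighbour-outside-base
        (subst (λ v → E G∘H v (f φ (inj₂ (a , h)))) (base-fixed φ a) (automorphism-preserves φ gh))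
        (copy-image-outside-base φ (a , h))

      restrictToCopy : Automorphism G∘H → V G → Automorphism H
      restrictToCopy φ a = restrict (copy a) φ (copy-invariant φ a) (copy-invariant (φ ⁻¹) a)

      corona-distinguishable : ∀ {s} → Distinguishable H (suc s) → Distinguishable G∘H (suc s)
      corona-distinguishable {s} (c , distinguishing) = cG∘H , distinguishing-corona
        where
          cG∘H : V G∘H → Fin (suc s)
          cG∘H (inj₁ _)       = zero
          cG∘H (inj₂ (_ , h)) = c h

          distinguishing-corona : Distinguishing G∘H cG∘H
          distinguishing-corona φ φ-preserves (inj₁ a)       = base-fixed φ a
          distinguishing-corona φ φ-preserves (inj₂ (a , h)) = begin
            f φ (inj₂ (a , h))  ≡⟨ sym (restriction-embed h) ⟩
            inj₂ (a , f ψ h)    ≡⟨ cong (λ h′ → inj₂ (a , h′)) (distinguishing ψ ψ-preserves h) ⟩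
            inj₂ (a , h)        ∎
            where
              open ≡-Reasoning
              ψ : Automorphism H
              ψ = restrictToCopy φ a
              restriction-embed : ∀ x → inj₂ (a , f ψ x) ≡ f φ (inj₂ (a , x))
              restriction-embed = restrict-embed (copy a) φ (copy-invariant φ a) (copy-invariant (φ ⁻¹) a)
              ψ-preserves : Preserves H c ψ
              ψ-preserves x = trans (cong cG∘H (restriction-embed x)) (φ-preserves (inj₂ (a , x)))

mainTheorem8 : (G H : Graph) → Finite G → Finite H → Connected G → Connected H → NotK1 G →
    ((IsDistNum G 1 → ∀ r → IsDistNum H r ⇔ IsDistNum (corona G H) r)
     × (IsDistNum (corona G H) 1 ⇔ (IsDistNum G 1 × IsDistNum H 1)))
mainTheorem8 G H finG finH (a₀ , walk) _ (u , v , u≢v) = part-i , part-ii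
  where
    open Corona G H
    open BaseInvariance finH (λ a → walks-to-distinct⇒neighbour (walk a u) (walk a v) u≢v)
    open OverAsymmetricBase using (corona-distinguishable)
    open Equivalence

    restrictToCopy-distinguishable : ∀ {s} → Distinguishable G∘H s → Distinguishable H s
    restrictToCopy-distinguishable = copy-distinguishable (finite⇒≡-dec G finG) a₀

    part-i : IsDistNum G 1 → ∀ r → IsDistNum H r ⇔ IsDistNum G∘H r
    part-i D[G]≡1 = isDistNum-cong λ _ →
      mk⇔ (corona-distinguishable (to isDistNum-1⇔asymmetric D[G]≡1)) restrictToCopy-distinguishable

    part-ii : IsDistNum G∘H 1 ⇔ (IsDistNum G 1 × IsDistNum H 1)
    part-ii = mk⇔
      (λ D[G∘H]≡1@(_ , distinguishable , _) →
        from isDistNum-1⇔asymmetric (asymmetric-corona⇒asymmetric-base (to isDistNum-1⇔asymmetric D[G∘H]≡1)) ,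
        from isDistNum-1⇔asymmetric (distinguishable-1⇒asymmetric (restrictToCopy-distinguishable distinguishable)))
      (λ (D[G]≡1 , (_ , distinguishable , _)) →
        from isDistNum-1⇔asymmetric (distinguishable-1⇒asymmetric
          (corona-distinguishable (to isDistNum-1⇔asymmetric D[G]≡1) distinguishable)))
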